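{- Let $k\geq 3$ be an integer, let \[ A=\{0,1\}\cup\{3,4,\ldots,k-1\}\cup\{k+2\}\subseteq \mathbb{Z}_{2k}, \] and let $v\in\mathbb{Z}_{2k}^{\times}$. Then \[ |A+v.\complement A|\geq 2k-1 . \]
   Context: $\mathbb{Z}_{2k}^{\times}$ is the group of units of $\mathbb{Z}_{2k}$; $\complement A=\mathbb{Z}_{2k}\setminus A$; for $v\in\mathbb{Z}_{2k}$ and $U\subseteq\mathbb{Z}_{2k}$, $v.U=\{vu: u\in U\}$; $U+V=\{u+w:u\in U,w\in V\}$. -}

module Defs where

open import Data.Nat using (ℕ; zero; suc; _+_; _*_; _≤_; _<_; NonZero)
open import Data.Nat.DivMod using (_%_)
open import Data.Fin using (Fin; toℕ; fromℕ<)
open import Data.Fin.Subset using (Subset)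
open import Data.Fin.Properties using (any?)
open import Data.Product using (Σ; _×_; _,_; ∃)
open import Data.Sum using (_⊎_)
open import Data.Vec using (tabulate)
open import Relation.Nullary using (¬_; Dec; does)
open import Relation.Nullary.Decidable using (_×-dec_; ¬?; _⊎-dec_)
open import Relation.Binary.PropositionalEquality using (_≡_)
import Data.Nat as ℕ
import Data.Fin as F

-- ℤ_{2k} is modelled as Fin (2 * k); element x represents the residue toℕ x.
ℤ[_] : ℕ → Set
ℤ[ n ] = Fin n

module _ (n : ℕ) .{{_ : NonZero n}} where
  _⊕_ : Fin n → Fin n → Fin n
  x ⊕ y = fromℕ< (Data.Nat.DivMod.m%n<n (toℕ x + toℕ y) n)

  _⊗_ : Fin n → Fin n → Fin n
  x ⊗ y = fromℕ< (Data.Nat.DivMod.m%n<n (toℕ x * toℕ y) n)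

  one : Fin n
  one = fromℕ< (Data.Nat.DivMod.m%n<n 1 n)

  IsUnit : Fin n → Set
  IsUnit v = ∃ λ u → (v ⊗ u) ≡ one

  InSumset : (A : Fin n → Set) → Fin n → Fin n → Set
  InSumset A v x = ∃ λ a → ∃ λ w → A a × ¬ A w × x ≡ (a ⊕ (v ⊗ w))

  sumset? : {A : Fin n → Set} → ((x : Fin n) → Dec (A x)) →
            (v x : Fin n) → Dec (InSumset A v x)
  sumset? A? v x = any? λ a → any? λ w →
    A? a ×-dec ¬? (A? w) ×-dec (x F.≟ (a ⊕ (v ⊗ w)))

  -- the subset A + v.∁A of ℤ_n, whose cardinality is ∣_∣ from Data.Fin.Subset
  sumsetSubset : {A : Fin n → Set} → ((x : Fin n) → Dec (A x)) →
                 Fin n → Subset n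
  sumsetSubset A? v = tabulate λ x → does (sumset? A? v x)

InA : (k : ℕ) → ℕ → Set
InA k m = (m ≡ 0 ⊎ m ≡ 1) ⊎ ((3 ≤ m × m < k) ⊎ m ≡ k + 2)

InA? : (k m : ℕ) → Dec (InA k m)
InA? k m = ((m ℕ.≟ 0) ⊎-dec (m ℕ.≟ 1)) ⊎-dec
           (((3 ℕ.≤? m) ×-dec (m ℕ.<? k)) ⊎-dec (m ℕ.≟ k + 2))

A : (k : ℕ) → Fin (2 * k) → Set
A k x = InA k (toℕ x)

A? : (k : ℕ) → (x : Fin (2 * k)) → Dec (A k x)
A? k x = InA? k (toℕ x)

module Submission where

-- Let N = 2k and S = A + v.∁A ⊆ ℤ_N.  We show that S misses at most one residue,
-- which gives |S| ≥ N - 1.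
--
-- The theorem follows: two distinct gaps x, x' would make x' - x a nonzero period of ∁A.

open import Defs
open import Data.Nat using (ℕ; zero; suc; pred; _+_; _*_; _∸_; _≤_; _<_; z≤n; s≤s; _<?_; NonZero; ≢-nonZero)
open import Data.Nat.Properties
  using ( +-comm; +-assoc; +-suc; *-comm; *-assoc; *-identityˡ; +-identityʳ; m∸n+n≡m; <⇒≤
        ; +-cancelˡ-≡; m≤m+n; m+n≮m; +-monoʳ-<; +-monoʳ-≤; <-≤-trans; m≤n⇒∃[o]m+o≡n
        ; ≮⇒≥; <-cmp; <⇒≱; n<1+n; m≤n+m∸n; ≤-trans; suc-pred)
open import Data.Nat.DivMod
  using (_%_; m%n<n; m%n%n≡m%n; %-distribˡ-+; %-distribˡ-*; [m+n]%n≡m%n; m<n⇒m%n≡m)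
open import Data.Nat.GeneralisedArithmetic using (fold; fold-+)
open import Data.Nat.Tactic.RingSolver using (solve-∀)
open import Data.Fin using (Fin; toℕ; fromℕ<) renaming (zero to fzero; suc to fsuc)
open import Data.Fin.Properties using (toℕ-fromℕ<; toℕ-injective; toℕ<n; suc-injective; pigeonhole; _≟_)
open import Data.Fin.Subset using (∣_∣)
open import Data.Vec using (tabulate)
open import Data.Bool using (Bool; true; false)
open import Data.Product using (∃-syntax; _×_; _,_)
open import Data.Sum using (inj₁; inj₂)
open import Data.Empty using (⊥-elim)
open import Function using (_∘_)
open import Function.Definitions using (Injective)
open import Relation.Nullary using (¬_; Dec; yes; no; does)
open import Relation.Binary using (tri<; tri≈; tri>)
open import Relation.Binary.Bundles using (Setoid)
open import Relation.Binary.PropositionalEquality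
import Relation.Binary.Construct.On as On
import Relation.Binary.Reasoning.Setoid as SetoidReasoning

module Modular (n : ℕ) .{{_ : NonZero n}} where

  ≡-mod-setoid : Setoid _ _
  ≡-mod-setoid = On.setoid {B = ℕ} (setoid ℕ) (_% n)

  open Setoid ≡-mod-setoid public using () renaming (_≈_ to _≡ₙ_; refl to ≡ₙ-refl)

  %-reduce : ∀ a → a % n ≡ₙ a
  %-reduce a = m%n%n≡m%n a n

  n≡ₙ0 : n ≡ₙ 0
  n≡ₙ0 = [m+n]%n≡m%n 0 n

  +-congₙ : ∀ {a a′ b b′} → a ≡ₙ a′ → b ≡ₙ b′ → a + b ≡ₙ a′ + b′
  +-congₙ {a} {a′} {b} {b′} p q = begin
    (a + b) % n               ≡⟨ %-distribˡ-+ a b n ⟩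
    (a % n + b % n) % n       ≡⟨ cong₂ (λ s t → (s + t) % n) p q ⟩
    (a′ % n + b′ % n) % n     ≡⟨ %-distribˡ-+ a′ b′ n ⟨
    (a′ + b′) % n             ∎
    where open ≡-Reasoning

  *-congₙ : ∀ {a a′ b b′} → a ≡ₙ a′ → b ≡ₙ b′ → a * b ≡ₙ a′ * b′
  *-congₙ {a} {a′} {b} {b′} p q = begin
    (a * b) % n               ≡⟨ %-distribˡ-* a b n ⟩
    (a % n * (b % n)) % n     ≡⟨ cong₂ (λ s t → (s * t) % n) p q ⟩
    (a′ % n * (b′ % n)) % n   ≡⟨ %-distribˡ-* a′ b′ n ⟨
    (a′ * b′) % n             ∎
    where open ≡-Reasoning

  ≡ₙ⇒≡ : ∀ {x y : Fin n} → toℕ x ≡ₙ toℕ y → x ≡ y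
  ≡ₙ⇒≡ {x} {y} p = toℕ-injective (begin
    toℕ x       ≡⟨ m<n⇒m%n≡m (toℕ<n x) ⟨
    toℕ x % n   ≡⟨ p ⟩
    toℕ y % n   ≡⟨ m<n⇒m%n≡m (toℕ<n y) ⟩
    toℕ y       ∎)
    where open ≡-Reasoning

  toℕ-add : ∀ x y → toℕ (_⊕_ n x y) ≡ₙ toℕ x + toℕ y
  toℕ-add x y = trans (cong (_% n) (toℕ-fromℕ< _)) (%-reduce (toℕ x + toℕ y))

  toℕ-mul : ∀ x y → toℕ (_⊗_ n x y) ≡ₙ toℕ x * toℕ y
  toℕ-mul x y = trans (cong (_% n) (toℕ-fromℕ< _)) (%-reduce (toℕ x * toℕ y))

  infixl 6 _+ₙ_ _-ₙ_
  infixl 7 _·ₙ_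

  _+ₙ_ _·ₙ_ : Fin n → Fin n → Fin n
  _+ₙ_ = _⊕_ n
  _·ₙ_ = _⊗_ n

  _-ₙ_ : Fin n → Fin n → Fin n
  x -ₙ y = fromℕ< (m%n<n (toℕ x + (n ∸ toℕ y)) n)

  toℕ-sub : ∀ x y → toℕ (x -ₙ y) ≡ₙ toℕ x + (n ∸ toℕ y)
  toℕ-sub x y = trans (cong (_% n) (toℕ-fromℕ< _)) (%-reduce (toℕ x + (n ∸ toℕ y)))

  -- adding y and n - y is adding a multiple of n
  +-cancel-negₙ : ∀ a (y : Fin n) → a + (n ∸ toℕ y) + toℕ y ≡ₙ a
  +-cancel-negₙ a y = begin
    a + (n ∸ toℕ y) + toℕ y   ≡⟨ +-assoc a _ _ ⟩
    a + ((n ∸ toℕ y) + toℕ y) ≡⟨ cong (a +_) (m∸n+n≡m (<⇒≤ (toℕ<n y))) ⟩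
    a + n                     ≈⟨ +-congₙ {a} ≡ₙ-refl n≡ₙ0 ⟩
    a + 0                     ≡⟨ +-identityʳ a ⟩
    a                         ∎
    where open SetoidReasoning ≡-mod-setoid

  +ₙ-comm : ∀ x y → x +ₙ y ≡ y +ₙ x
  +ₙ-comm x y = ≡ₙ⇒≡ (begin
    toℕ (x +ₙ y)    ≈⟨ toℕ-add x y ⟩
    toℕ x + toℕ y   ≡⟨ +-comm (toℕ x) (toℕ y) ⟩
    toℕ y + toℕ x   ≈⟨ toℕ-add y x ⟨
    toℕ (y +ₙ x)    ∎)
    where open SetoidReasoning ≡-mod-setoid

  +ₙ-assoc : ∀ x y z → x +ₙ y +ₙ z ≡ x +ₙ (y +ₙ z)
  +ₙ-assoc x y z = ≡ₙ⇒≡ (begin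
    toℕ (x +ₙ y +ₙ z)            ≈⟨ toℕ-add (x +ₙ y) z ⟩
    toℕ (x +ₙ y) + toℕ z         ≈⟨ +-congₙ (toℕ-add x y) (≡ₙ-refl {toℕ z}) ⟩
    toℕ x + toℕ y + toℕ z        ≡⟨ +-assoc (toℕ x) _ _ ⟩
    toℕ x + (toℕ y + toℕ z)      ≈⟨ +-congₙ (≡ₙ-refl {toℕ x}) (toℕ-add y z) ⟨
    toℕ x + toℕ (y +ₙ z)         ≈⟨ toℕ-add x (y +ₙ z) ⟨
    toℕ (x +ₙ (y +ₙ z))          ∎)
    where open SetoidReasoning ≡-mod-setoid

  [x-y]+y≡x : ∀ x y → x -ₙ y +ₙ y ≡ x
  [x-y]+y≡x x y = ≡ₙ⇒≡ (begin
    toℕ (x -ₙ y +ₙ y)               ≈⟨ toℕ-add (x -ₙ y) y ⟩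
    toℕ (x -ₙ y) + toℕ y            ≈⟨ +-congₙ (toℕ-sub x y) (≡ₙ-refl {toℕ y}) ⟩
    toℕ x + (n ∸ toℕ y) + toℕ y     ≈⟨ +-cancel-negₙ (toℕ x) y ⟩
    toℕ x                           ∎)
    where open SetoidReasoning ≡-mod-setoid

  [x+y]-y≡x : ∀ x y → x +ₙ y -ₙ y ≡ x
  [x+y]-y≡x x y = ≡ₙ⇒≡ (begin
    toℕ (x +ₙ y -ₙ y)                 ≈⟨ toℕ-sub (x +ₙ y) y ⟩
    toℕ (x +ₙ y) + (n ∸ toℕ y)        ≈⟨ +-congₙ (toℕ-add x y) (≡ₙ-refl {n ∸ toℕ y}) ⟩
    toℕ x + toℕ y + (n ∸ toℕ y)       ≡⟨ cong (_+ (n ∸ toℕ y)) (+-comm (toℕ x) _) ⟩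
    toℕ y + toℕ x + (n ∸ toℕ y)       ≡⟨ +-assoc (toℕ y) _ _ ⟩
    toℕ y + (toℕ x + (n ∸ toℕ y))     ≡⟨ +-comm (toℕ y) _ ⟩
    toℕ x + (n ∸ toℕ y) + toℕ y       ≈⟨ +-cancel-negₙ (toℕ x) y ⟩
    toℕ x                             ∎)
    where open SetoidReasoning ≡-mod-setoid

  -- x - p determines p: it is recovered as x - (x - p)
  -ₙ-injectiveʳ : ∀ x {p q} → x -ₙ p ≡ x -ₙ q → p ≡ q
  -ₙ-injectiveʳ x {p} {q} eq = trans (recover p) (trans (cong (x -ₙ_) eq) (sym (recover q)))
    where
    recover : ∀ r → r ≡ x -ₙ (x -ₙ r)
    recover r = begin
      r                        ≡⟨ [x+y]-y≡x r (x -ₙ r) ⟨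
      r +ₙ (x -ₙ r) -ₙ (x -ₙ r)  ≡⟨ cong (_-ₙ (x -ₙ r)) (+ₙ-comm r (x -ₙ r)) ⟩
      x -ₙ r +ₙ r -ₙ (x -ₙ r)    ≡⟨ cong (_-ₙ (x -ₙ r)) ([x-y]+y≡x x r) ⟩
      x -ₙ (x -ₙ r)              ∎
      where open ≡-Reasoning

  -ₙ≡0⇒≡ : ∀ x y → toℕ (x -ₙ y) ≡ 0 → x ≡ y
  -ₙ≡0⇒≡ x y d≡0 = trans (sym ([x-y]+y≡x x y)) (≡ₙ⇒≡ (begin
    toℕ (x -ₙ y +ₙ y)     ≈⟨ toℕ-add (x -ₙ y) y ⟩
    toℕ (x -ₙ y) + toℕ y  ≡⟨ cong (_+ toℕ y) d≡0 ⟩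
    toℕ y                 ∎))
    where open SetoidReasoning ≡-mod-setoid

  ·ₙ-unit-injective : ∀ v → IsUnit n v → ∀ {w w′} → v ·ₙ w ≡ v ·ₙ w′ → w ≡ w′
  ·ₙ-unit-injective v (u , vu≡1) {w} {w′} eq = ≡ₙ⇒≡ (begin
    toℕ w                   ≈⟨ recover w ⟨
    toℕ u * toℕ (v ·ₙ w)    ≡⟨ cong (λ t → toℕ u * toℕ t) eq ⟩
    toℕ u * toℕ (v ·ₙ w′)   ≈⟨ recover w′ ⟩
    toℕ w′                  ∎)
    where
    open SetoidReasoning ≡-mod-setoid
    vu≡ₙ1 : toℕ v * toℕ u ≡ₙ 1
    vu≡ₙ1 = begin
      toℕ v * toℕ u   ≈⟨ toℕ-mul v u ⟨
      toℕ (v ·ₙ u)    ≡⟨ cong toℕ vu≡1 ⟩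
      toℕ (one n)     ≡⟨ toℕ-fromℕ< _ ⟩
      1 % n           ≈⟨ %-reduce 1 ⟩
      1               ∎
    recover : ∀ t → toℕ u * toℕ (v ·ₙ t) ≡ₙ toℕ t
    recover t = begin
      toℕ u * toℕ (v ·ₙ t)        ≈⟨ *-congₙ (≡ₙ-refl {toℕ u}) (toℕ-mul v t) ⟩
      toℕ u * (toℕ v * toℕ t)     ≡⟨ *-assoc (toℕ u) _ _ ⟨
      toℕ u * toℕ v * toℕ t       ≡⟨ cong (_* toℕ t) (*-comm (toℕ u) _) ⟩
      toℕ v * toℕ u * toℕ t       ≈⟨ *-congₙ vu≡ₙ1 (≡ₙ-refl {toℕ t}) ⟩
      1 * toℕ t                   ≡⟨ *-identityˡ (toℕ t) ⟩
      toℕ t                       ∎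

-- An injective self-map g of Fin n that sends a subset P into itself maps P onto P:
-- by pigeonhole the g-orbit of c ∈ P returns to c, and its predecessor lies in P.
module _ {n : ℕ} (g : Fin n → Fin n) (g-injective : Injective _≡_ _≡_ g) where

  fold-cancel : ∀ i {a b} → fold a g i ≡ fold b g i → a ≡ b
  fold-cancel zero    eq = eq
  fold-cancel (suc i) eq = fold-cancel i (g-injective eq)

  injective-onto : (P : Fin n → Set) → (∀ {w} → P w → P (g w)) →
                   ∀ {c} → P c → ∃[ w ] P w × g w ≡ c
  injective-onto P g-preserves {c} Pc with pigeonhole (n<1+n n) (λ i → fold c g (toℕ i))
  ... | i , j , i<j , same with m≤n⇒∃[o]m+o≡n i<j
  ...   | e , 1+i+e≡j = fold c g e , stays e , sym returns
    where
    stays : ∀ m → P (fold c g m)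
    stays zero    = Pc
    stays (suc m) = g-preserves (stays m)

    returns : c ≡ g (fold c g e)
    returns = fold-cancel (toℕ i) (begin
      fold c g (toℕ i)                   ≡⟨ same ⟩
      fold c g (toℕ j)                   ≡⟨ cong (fold c g) (trans (sym 1+i+e≡j) (sym (+-suc (toℕ i) e))) ⟩
      fold c g (toℕ i + suc e)           ≡⟨ fold-+ c g (toℕ i) ⟩
      fold (fold c g (suc e)) g (toℕ i)  ∎)
      where open ≡-Reasoning

-- The map w ↦ x - v w is
-- injective and sends ∁A into ∁A (otherwise x ∈ A + v.∁A), so every c ∉ A is x - v w
-- with w ∉ A; then c + (x' - x) + v w = x', so c + (x' - x) ∈ A would put x' in the sumset.
module _ (n : ℕ) .{{_ : NonZero n}} (P : Fin n → Set) (v : Fin n) (v-unit : IsUnit n v) where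
  open Modular n

  reflect : Fin n → Fin n → Fin n
  reflect x w = x -ₙ v ·ₙ w

  reflect-injective : ∀ x → Injective _≡_ _≡_ (reflect x)
  reflect-injective x {w} {w′} eq =
    ·ₙ-unit-injective v v-unit {w} {w′} (-ₙ-injectiveʳ x {v ·ₙ w} {v ·ₙ w′} eq)

  reflect-preserves : ∀ {x} → ¬ InSumset n P v x → ∀ {w} → ¬ P w → ¬ P (reflect x w)
  reflect-preserves {x} x∉S {w} w∉P xw∈P = x∉S (reflect x w , w , xw∈P , w∉P , sym ([x-y]+y≡x x (v ·ₙ w)))

  gaps⇒period : ∀ {x x′} → ¬ InSumset n P v x → ¬ InSumset n P v x′ →
                ∀ {c} → ¬ P c → ¬ P (c +ₙ (x′ -ₙ x))
  gaps⇒period {x} {x′} x∉S x′∉S {c} c∉P c+d∈P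
    with injective-onto (reflect x) (reflect-injective x) (¬_ ∘ P) (reflect-preserves x∉S) c∉P
  ... | w , w∉P , xw≡c = x′∉S (c +ₙ d , w , c+d∈P , w∉P , sym reaches-x′)
    where
    d = x′ -ₙ x

    reaches-x′ : c +ₙ d +ₙ v ·ₙ w ≡ x′
    reaches-x′ = begin
      c +ₙ d +ₙ v ·ₙ w              ≡⟨ +ₙ-assoc c d _ ⟩
      c +ₙ (d +ₙ v ·ₙ w)            ≡⟨ cong (c +ₙ_) (+ₙ-comm d _) ⟩
      c +ₙ (v ·ₙ w +ₙ d)            ≡⟨ +ₙ-assoc c _ d ⟨
      c +ₙ v ·ₙ w +ₙ d              ≡⟨ cong (λ t → t +ₙ v ·ₙ w +ₙ d) xw≡c ⟨
      reflect x w +ₙ v ·ₙ w +ₙ d    ≡⟨ cong (_+ₙ d) ([x-y]+y≡x x (v ·ₙ w)) ⟩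
      x +ₙ d                        ≡⟨ +ₙ-comm x d ⟩
      x′ -ₙ x +ₙ x                  ≡⟨ [x-y]+y≡x x′ x ⟩
      x′                            ∎
      where open ≡-Reasoning

module Membership (j : ℕ) where
  k N : ℕ
  k = 3 + j
  N = 2 * k

  Escape : ℕ → Set
  Escape D = ∃[ c ] c < N × ¬ InA k c × InA k ((c + D) % N)

  escape-direct : ∀ {D} c → c < N → ¬ InA k c → c + D < N → InA k (c + D) → Escape D
  escape-direct {D} c c<N c∉A c+D<N c+D∈A =
    c , c<N , c∉A , subst (InA k) (sym (m<n⇒m%n≡m c+D<N)) c+D∈A

  escape-wrap : ∀ {D} c → c < N → ¬ InA k c → ∀ e → c + D ≡ e + N → e < N → InA k e → Escape D
  escape-wrap {D} c c<N c∉A e c+D≡e+N e<N e∈A = c , c<N , c∉A , subst (InA k) (sym reduces) e∈A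
    where
    reduces : (c + D) % N ≡ e
    reduces = trans (cong (_% N) c+D≡e+N) (trans ([m+n]%n≡m%n e N) (m<n⇒m%n≡m e<N))

  0∈A : InA k 0
  0∈A = inj₁ (inj₁ refl)

  1∈A : InA k 1
  1∈A = inj₁ (inj₂ refl)

  middle∈A : ∀ {m} → 3 ≤ m → m < k → InA k m
  middle∈A 3≤m m<k = inj₂ (inj₁ (3≤m , m<k))

  2∉A : ¬ InA k 2
  2∉A (inj₁ (inj₁ ()))
  2∉A (inj₁ (inj₂ ()))
  2∉A (inj₂ (inj₁ (s≤s (s≤s ()) , _)))
  2∉A (inj₂ (inj₂ ()))

  upper∉A : ∀ e → e ≢ 2 → ¬ InA k (k + e)
  upper∉A e e≢2 (inj₁ (inj₁ ()))
  upper∉A e e≢2 (inj₁ (inj₂ ()))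
  upper∉A e e≢2 (inj₂ (inj₁ (_ , k+e<k))) = m+n≮m k e k+e<k
  upper∉A e e≢2 (inj₂ (inj₂ k+e≡k+2)) = e≢2 (+-cancelˡ-≡ k e 2 k+e≡k+2)

  upper<N : ∀ {e} → e < k → k + e < N
  upper<N {e} e<k = subst (k + e <_) (cong (k +_) (sym (+-identityʳ k))) (+-monoʳ-< k e<k)

  small<N : ∀ {m} → m < k → m < N
  small<N m<k = <-≤-trans m<k (m≤m+n k (k + 0))

  0<k : 0 < k
  0<k = s≤s z≤n

  1<k : 1 < k
  1<k = s≤s (s≤s z≤n)

  2<k : 2 < k
  2<k = s≤s (s≤s (s≤s z≤n))

open Membership

-- Shifts D = j + 1 + s, i.e. k - 2 ≤ D < N.  Each case names the escaping residue c
-- (outside A) and the element of A that c + D reduces to.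
escape-upper : ∀ j s → suc (j + s) < N j → Escape j (suc (j + s))
-- k = 3, D = 1: 4 + 1 = 5 = k + 2
escape-upper zero 0 _ =
  escape-direct 0 4 (upper<N 0 (1<k 0)) (upper∉A 0 1 λ ()) (upper<N 0 (2<k 0)) (inj₂ (inj₂ refl))
-- k ≥ 4, D = k - 2: (k + 3) + D ≡ 1
escape-upper (suc j) 0 _ =
  escape-wrap (suc j) (k (suc j) + 3) (upper<N (suc j) (s≤s (2<k j))) (upper∉A (suc j) 3 λ ())
              1 (eq j) (small<N (suc j) (1<k (suc j))) (1∈A (suc j))
  where eq : ∀ j → 3 + suc j + 3 + suc (suc j + 0) ≡ 1 + 2 * (3 + suc j)
        eq = solve-∀
-- D = k - 1: (k + 1) + D ≡ 0
escape-upper j 1 _ =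
  escape-wrap j (k j + 1) (upper<N j (1<k j)) (upper∉A j 1 λ ()) 0 (eq j) (small<N j (0<k j)) (0∈A j)
  where eq : ∀ j → 3 + j + 1 + suc (j + 1) ≡ 0 + 2 * (3 + j)
        eq = solve-∀
-- D = k: k + D ≡ 0
escape-upper j 2 _ =
  escape-wrap j (k j + 0) (upper<N j (0<k j)) (upper∉A j 0 λ ()) 0 (eq j) (small<N j (0<k j)) (0∈A j)
  where eq : ∀ j → 3 + j + 0 + suc (j + 2) ≡ 0 + 2 * (3 + j)
        eq = solve-∀
-- D = k + 1: k + D ≡ 1
escape-upper j 3 _ =
  escape-wrap j (k j + 0) (upper<N j (0<k j)) (upper∉A j 0 λ ()) 1 (eq j) (small<N j (1<k j)) (1∈A j)
  where eq : ∀ j → 3 + j + 0 + suc (j + 3) ≡ 1 + 2 * (3 + j)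
        eq = solve-∀
escape-upper j (suc (suc (suc (suc r)))) D<N with <-cmp r j
-- D = k + 2 + r with r < k - 3: (k + 1) + D ≡ 3 + r, which lies in {3, …, k - 1}
... | tri< r<j _ _ =
  escape-wrap j (k j + 1) (upper<N j (1<k j)) (upper∉A j 1 λ ()) (3 + r) (eq j r)
              (small<N j 3+r<k) (middle∈A j (m≤m+n 3 r) 3+r<k)
  where eq : ∀ j r → 3 + j + 1 + suc (j + (4 + r)) ≡ 3 + r + 2 * (3 + j)
        eq = solve-∀
        3+r<k : 3 + r < k j
        3+r<k = s≤s (s≤s (s≤s r<j))
-- D = N - 1: 2 + D ≡ 1
... | tri≈ _ refl _ =
  escape-wrap j 2 (small<N j (2<k j)) (2∉A j) 1 (eq j) (small<N j (1<k j)) (1∈A j)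
  where eq : ∀ j → 2 + suc (j + (4 + j)) ≡ 1 + 2 * (3 + j)
        eq = solve-∀
... | tri> _ _ j<r = ⊥-elim (<⇒≱ D<N (subst₂ _≤_ (eqN j) (eqD j r) (+-monoʳ-≤ (5 + j) j<r)))
  where eqN : ∀ j → 5 + j + suc j ≡ 2 * (3 + j)
        eqN = solve-∀
        eqD : ∀ j r → 5 + j + r ≡ suc (j + (4 + r))
        eqD = solve-∀

-- Every shift 0 < D < N moves some element of ∁A into A.  Small shifts D ≤ k - 3
-- move 2 ∉ A to 2 + D ∈ {3, …, k - 1}; the others are handled by escape-upper.
escape : ∀ j D → suc D < N j → Escape j (suc D)
escape j D D<N with D <? j
... | yes D<j =
  escape-direct j 2 (small<N j (2<k j)) (2∉A j) (small<N j 3+D<k) (middle∈A j (m≤m+n 3 D) 3+D<k)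
  where 3+D<k : 3 + D < k j
        3+D<k = s≤s (s≤s (s≤s D<j))
... | no D≮j with m≤n⇒∃[o]m+o≡n (≮⇒≥ D≮j)
...   | s , refl = escape-upper j s D<N

AtMostOneFalse : ∀ {n} → (Fin n → Bool) → Set
AtMostOneFalse f = ∀ i j → f i ≡ false → f j ≡ false → i ≡ j

all-true⇒full : ∀ {n} (f : Fin n → Bool) → (∀ i → f i ≡ true) → n ≤ ∣ tabulate f ∣
all-true⇒full {zero}  f all = z≤n
all-true⇒full {suc n} f all with f fzero | all fzero
... | true | _ = s≤s (all-true⇒full (f ∘ fsuc) (all ∘ fsuc))

at-most-one-false⇒ : ∀ {n} (f : Fin n → Bool) → AtMostOneFalse f → n ∸ 1 ≤ ∣ tabulate f ∣
at-most-one-false⇒ {zero}  f unique = z≤n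
at-most-one-false⇒ {suc n} f unique with f fzero in f0
... | true  = ≤-trans (m≤n+m∸n n 1) (s≤s (at-most-one-false⇒ (f ∘ fsuc) unique-tail))
  where
  unique-tail : AtMostOneFalse (f ∘ fsuc)
  unique-tail i j fi fj = suc-injective (unique (fsuc i) (fsuc j) fi fj)
... | false = all-true⇒full (f ∘ fsuc) rest-true
  where
  rest-true : ∀ i → f (fsuc i) ≡ true
  rest-true i with f (fsuc i) in fi
  ... | true  = refl
  ... | false with () ← unique fzero (fsuc i) f0 fi

does-false⇒¬ : ∀ {P : Set} (P? : Dec P) → does P? ≡ false → ¬ P
does-false⇒¬ (no ¬p) _ = ¬p

complement-not-periodic : ∀ j (d : Fin (N j)) → toℕ d ≢ 0 →
                          ∃[ c ] ¬ A (k j) c × A (k j) (_⊕_ (N j) c d)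
complement-not-periodic j d d≢0 = to-Fin (escape j (pred (toℕ d)) (subst (_< N j) (sym 1+D≡d) (toℕ<n d)))
  where
  instance _ = ≢-nonZero d≢0
  1+D≡d : suc (pred (toℕ d)) ≡ toℕ d
  1+D≡d = suc-pred (toℕ d)

  to-Fin : Escape j (suc (pred (toℕ d))) → ∃[ c ] ¬ A (k j) c × A (k j) (_⊕_ (N j) c d)
  to-Fin (c , c<N , c∉A , c+D∈A) = fromℕ< c<N , c′∉A , c′+d∈A
    where
    c′∉A : ¬ A (k j) (fromℕ< c<N)
    c′∉A = subst (λ t → ¬ InA (k j) t) (sym (toℕ-fromℕ< c<N)) c∉A

    c′+d∈A : A (k j) (_⊕_ (N j) (fromℕ< c<N) d)
    c′+d∈A = subst (InA (k j)) (sym (trans (toℕ-fromℕ< _)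
               (cong₂ (λ s t → (s + t) % N j) (toℕ-fromℕ< c<N) (sym 1+D≡d)))) c+D∈A

mainTheorem3 : (k : ℕ) → 3 ≤ k → .{{_ : NonZero (2 * k)}} →
    (v : Fin (2 * k)) → IsUnit (2 * k) v →
    2 * k ∸ 1 ≤ ∣ sumsetSubset (2 * k) (A? k) v ∣
mainTheorem3 (suc (suc (suc j))) (s≤s (s≤s (s≤s z≤n))) v v-unit =
  at-most-one-false⇒ (λ x → does (sumset? (N j) (A? (k j)) v x)) at-most-one-gap
  where
  open Modular (N j)

  -- two gaps x, x' of the sumset coincide: otherwise x' - x would be a period of ∁A
  at-most-one-gap : AtMostOneFalse (λ x → does (sumset? (N j) (A? (k j)) v x))
  at-most-one-gap x x′ x-gap x′-gap with x ≟ x′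
  ... | yes x≡x′ = x≡x′
  ... | no  x≢x′ =
    let c , c∉A , c+d∈A = complement-not-periodic j (x′ -ₙ x) (λ d≡0 → x≢x′ (sym (-ₙ≡0⇒≡ x′ x d≡0)))
    in  ⊥-elim (gaps⇒period (N j) (A (k j)) v v-unit {x} {x′} (gap x x-gap) (gap x′ x′-gap) {c} c∉A c+d∈A)
    where
    gap : ∀ y → does (sumset? (N j) (A? (k j)) v y) ≡ false → ¬ InSumset (N j) (A (k j)) v y
    gap y = does-false⇒¬ (sumset? (N j) (A? (k j)) v y)
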